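{- The ratio $Z(2n)/Z(n)$, as $n$ ranges over the positive integers, is not bounded above.
   Context: For a positive integer $m$ let $T(m) = m(m+1)/2$ denote the $m$-th triangular number. The pseudo-Smarandache function is defined for positive integers $n$ by $Z(n) = \min\{ m \ge 1 : n \mid T(m) \}$. -}

module Defs where

open import Data.Nat using (ℕ; zero; suc; _+_; _*_; _/_)
open import Data.Nat.Divisibility using (_∣_; _∣?_)
open import Relation.Nullary using (yes; no)

T : ℕ → ℕ
T m = (m * suc m) / 2

search : ℕ → ℕ → ℕ → ℕ
search n k zero = k
search n k (suc fuel) with n ∣? T k
... | yes _ = k
... | no _ = search n (suc k) fuel

-- pseudo-Smarandache function: Z(n) = min { m ≥ 1 : n ∣ T(m) }.
-- For n ≥ 1 we have n ∣ T(2n-1) = n(2n-1), so searching m = 1, 2, ..., 2n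
-- finds the true minimum.  (Value at n = 0 is irrelevant.)
Z : ℕ → ℕ
Z n = search n 1 (2 * n)

{-# OPTIONS --safe #-}
-- Let A = 2^(3^C) and B = 3^(C+1), so that B ∣ A + 1 by lifting the exponent. For n = (A/2)·B,
-- n divides T(A) = (A/2)(A+1), hence Z(n) ≤ A. With r = Z(2n), AB ∣ T(r) forces the prime powers
-- 2A and B each to divide r or r+1, so B divides a number within 1 of a multiple Au of A that is
-- within 1 of r; as A ≡ -1 (mod B) this gives B ≤ u + 1, i.e. AB ≤ r + 1 + A. Since B ≥ C + 3,
-- Z(2n) = r > C·A ≥ C·Z(n).
module Submission where

open import Defs
open import Data.Nat using (ℕ; _*_; _<_; _≥_)
open import Data.Product using (∃-syntax; _×_)

open import Data.Nat
  using (zero; suc; pred; _+_; _∸_; _^_; _≤_; z≤n; s≤s; NonZero; >-nonZero; >-nonZero⁻¹; nonTrivial⇒≢1)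
open import Data.Nat.Properties
open import Data.Nat.Divisibility
open import Data.Nat.DivMod using (m/n*n≡m)
open import Data.Nat.Coprimality using (Coprime)
open import Data.Nat.Primality
  using (Prime; prime?; prime[2]; euclidsLemma; prime⇒nonZero; prime⇒nonTrivial)
open import Data.Nat.Tactic.RingSolver using (solve-∀)
open import Data.Product using (_,_)
open import Data.Sum using (_⊎_; inj₁; inj₂)
open import Relation.Nullary using (¬_; yes; no; contradiction)
open import Relation.Nullary.Decidable using (toWitness)
open import Relation.Binary.PropositionalEquality

2∣m*[1+m] : ∀ m → 2 ∣ m * suc m
2∣m*[1+m] zero    = 2 ∣0
2∣m*[1+m] (suc m) = subst (2 ∣_) (step m) (∣m∣n⇒∣m+n (2∣m*[1+m] m) (n∣m*n (suc m)))
  where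
  step : ∀ m → m * suc m + suc m * 2 ≡ suc m * suc (suc m)
  step = solve-∀

T*2≡m*[1+m] : ∀ m → T m * 2 ≡ m * suc m
T*2≡m*[1+m] m = m/n*n≡m (2∣m*[1+m] m)

T[2m]≡m*[1+2m] : ∀ m → T (2 * m) ≡ m * suc (2 * m)
T[2m]≡m*[1+2m] m = *-cancelʳ-≡ _ _ 2 (trans (T*2≡m*[1+m] (2 * m)) (halve m))
  where
  halve : ∀ m → 2 * m * suc (2 * m) ≡ m * suc (2 * m) * 2
  halve = solve-∀

T[1+2m]≡[1+m]*[1+2m] : ∀ m → T (suc (2 * m)) ≡ suc m * suc (2 * m)
T[1+2m]≡[1+m]*[1+2m] m = *-cancelʳ-≡ _ _ 2 (trans (T*2≡m*[1+m] (suc (2 * m))) (halve m))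
  where
  halve : ∀ m → suc (2 * m) * suc (suc (2 * m)) ≡ suc m * suc (2 * m) * 2
  halve = solve-∀

∣T⇒*2∣m*[1+m] : ∀ {n m} → n ∣ T m → n * 2 ∣ m * suc m
∣T⇒*2∣m*[1+m] {n} {m} n∣Tm = subst (n * 2 ∣_) (T*2≡m*[1+m] m) (*-monoˡ-∣ 2 n∣Tm)

search-≥ : ∀ n k f → k ≤ search n k f
search-≥ n k zero = ≤-refl
search-≥ n k (suc f) with n ∣? T k
... | yes _ = ≤-refl
... | no _  = ≤-trans (n≤1+n k) (search-≥ n (suc k) f)

search-least : ∀ n f k m → k ≤ m → m ≤ k + f → n ∣ T m → search n k f ≤ m
search-least n zero    k m k≤m _   _    = k≤m
search-least n (suc f) k m k≤m m≤k+f n∣Tm with n ∣? T k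
... | yes _ = k≤m
... | no n∤Tk with k ≟ m
...   | yes refl = contradiction n∣Tm n∤Tk
...   | no k≢m   = search-least n f (suc k) m (≤∧≢⇒< k≤m k≢m) (subst (m ≤_) (+-suc k f) m≤k+f) n∣Tm

search-found⊎exhausted : ∀ n k f → n ∣ T (search n k f) ⊎ search n k f ≡ k + f
search-found⊎exhausted n k zero = inj₂ (sym (+-identityʳ k))
search-found⊎exhausted n k (suc f) with n ∣? T k
... | yes n∣Tk = inj₁ n∣Tk
... | no _ with search-found⊎exhausted n (suc k) f
...   | inj₁ found     = inj₁ found
...   | inj₂ exhausted = inj₂ (trans exhausted (sym (+-suc k f)))

Z-positive : ∀ n → 1 ≤ Z n
Z-positive n = search-≥ n 1 (2 * n)

Z-least : ∀ {n m} → 1 ≤ m → m ≤ suc (2 * n) → n ∣ T m → Z n ≤ m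
Z-least {n} {m} = search-least n (2 * n) 1 m

Z-divides : ∀ n → .{{NonZero n}} → n ∣ T (Z n)
Z-divides n@(suc k) with search-found⊎exhausted n 1 (2 * n)
... | inj₁ found     = found
... | inj₂ exhausted = contradiction Z≤1+2k (<⇒≱ (subst (suc (2 * k) <_) (sym exhausted) 1+2k<1+2n))
  where
  1+2k<1+2n : suc (2 * k) < suc (2 * n)
  1+2k<1+2n = s≤s (*-monoʳ-< 2 (n<1+n k))
  Z≤1+2k : Z n ≤ suc (2 * k)
  Z≤1+2k = Z-least (s≤s z≤n) (<⇒≤ 1+2k<1+2n)
             (subst (n ∣_) (sym (T[1+2m]≡[1+m]*[1+2m] k)) (m∣m*n (suc (2 * k))))

Z[m*d]≤2m : ∀ m d → .{{NonZero m}} → d ∣ suc (2 * m) → Z (m * d) ≤ 2 * m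
Z[m*d]≤2m m zero      0∣1+2m = contradiction (0∣⇒≡0 0∣1+2m) λ ()
Z[m*d]≤2m m d@(suc _) d∣1+2m = Z-least 1≤2m (≤-trans (*-monoʳ-≤ 2 (m≤m*n m d)) (n≤1+n _))
  (subst (m * d ∣_) (sym (T[2m]≡m*[1+2m] m)) (*-monoʳ-∣ m d∣1+2m))
  where
  1≤2m : 1 ≤ 2 * m
  1≤2m = ≤-trans (>-nonZero⁻¹ m) (m≤n*m m 2)

coprime-suc : ∀ n → Coprime n (suc n)
coprime-suc n {d} (d∣n , d∣1+n) = ∣1⇒≡1 (∣m+n∣m⇒∣n (subst (d ∣_) (+-comm 1 n) d∣1+n) d∣n)

p^e∣m*n∧p∤n⇒p^e∣m : ∀ {p m n} e → Prime p → ¬ p ∣ n → p ^ e ∣ m * n → p ^ e ∣ m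
p^e∣m*n∧p∤n⇒p^e∣m zero _ _ _ = 1∣ _
p^e∣m*n∧p∤n⇒p^e∣m {p} {m} {n} (suc e) p-prime p∤n p^[1+e]∣mn
  with euclidsLemma m n p-prime (∣-trans (m∣m*n (p ^ e)) p^[1+e]∣mn)
... | inj₂ p∣n = contradiction p∣n p∤n
... | inj₁ (divides-refl q) =
  subst (p ^ suc e ∣_) (*-comm p q) (*-monoʳ-∣ p (p^e∣m*n∧p∤n⇒p^e∣m e p-prime p∤n p^e∣qn))
  where
  regroup : ∀ q p n → q * p * n ≡ p * (q * n)
  regroup = solve-∀
  p^e∣qn : p ^ e ∣ q * n
  p^e∣qn = *-cancelˡ-∣ p {{prime⇒nonZero p-prime}} (subst (p ^ suc e ∣_) (regroup q p n) p^[1+e]∣mn)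

p^e∣m*n⇒p^e∣m⊎p^e∣n : ∀ {p m n} e → Prime p → Coprime m n → p ^ e ∣ m * n → p ^ e ∣ m ⊎ p ^ e ∣ n
p^e∣m*n⇒p^e∣m⊎p^e∣n {p} {m} {n} e p-prime coprime p^e∣mn with p ∣? n
... | no p∤n  = inj₁ (p^e∣m*n∧p∤n⇒p^e∣m e p-prime p∤n p^e∣mn)
... | yes p∣n = inj₂ (p^e∣m*n∧p∤n⇒p^e∣m e p-prime p∤m (subst (p ^ e ∣_) (*-comm m n) p^e∣mn))
  where
  p∤m : ¬ p ∣ m
  p∤m p∣m = nonTrivial⇒≢1 {{prime⇒nonTrivial p-prime}} (coprime (p∣m , p∣n))

3^[1+k]∣1+x⇒3^[2+k]∣1+x^3 : ∀ k x → 3 ^ suc k ∣ suc x → 3 ^ suc (suc k) ∣ suc (x ^ 3)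
3^[1+k]∣1+x⇒3^[2+k]∣1+x^3 k x 3^[1+k]∣1+x =
  ∣m+n∣m⇒∣n (subst (3 ^ suc (suc k) ∣_) (sym (cube x)) 3^[2+k]∣[1+x]^3) 3^[2+k]∣3x[1+x]
  where
  cube : ∀ x → 3 * (x * suc x) + suc (x * (x * (x * 1))) ≡ suc x * (suc x * (suc x * 1))
  cube = solve-∀
  3^[2+k]∣[1+x]^3 : 3 ^ suc (suc k) ∣ suc x ^ 3
  3^[2+k]∣[1+x]^3 =
    *-pres-∣ (∣-trans (m∣m*n {3} (3 ^ k)) 3^[1+k]∣1+x) (∣m⇒∣m*n (suc x * 1) 3^[1+k]∣1+x)
  3^[2+k]∣3x[1+x] : 3 ^ suc (suc k) ∣ 3 * (x * suc x)
  3^[2+k]∣3x[1+x] = *-monoʳ-∣ 3 (∣n⇒∣m*n x 3^[1+k]∣1+x)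

3^[1+k]∣1+2^3^k : ∀ k → 3 ^ suc k ∣ suc (2 ^ 3 ^ k)
3^[1+k]∣1+2^3^k zero    = ∣-refl
3^[1+k]∣1+2^3^k (suc k) =
  subst (λ x → 3 ^ suc (suc k) ∣ suc x) cube-exponent
    (3^[1+k]∣1+x⇒3^[2+k]∣1+x^3 k (2 ^ 3 ^ k) (3^[1+k]∣1+2^3^k k))
  where
  cube-exponent : (2 ^ 3 ^ k) ^ 3 ≡ 2 ^ 3 ^ suc k
  cube-exponent = trans (^-*-assoc 2 (3 ^ k) 3) (cong (2 ^_) (*-comm (3 ^ k) 3))

3+n≤3^[1+n] : ∀ n → 3 + n ≤ 3 ^ suc n
3+n≤3^[1+n] zero    = ≤-refl
3+n≤3^[1+n] (suc n) = begin
  3 + suc n     ≤⟨ m<m*n (3 + n) 3 (s≤s (s≤s z≤n)) ⟩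
  (3 + n) * 3   ≡⟨ *-comm (3 + n) 3 ⟩
  3 * (3 + n)   ≤⟨ *-monoʳ-≤ 3 (3+n≤3^[1+n] n) ⟩
  3 ^ suc (suc n) ∎
  where open ≤-Reasoning

-- A ≡ -1 (mod B) makes B divide (1 + A) u - s, a positive number at most 1 + u.
∣-near-multiple⇒≤ : ∀ {A B s u} → B ∣ suc A → B ∣ s → s < suc A * u → A * u ≤ suc s → B ≤ suc u
∣-near-multiple⇒≤ {A} {B} {s} {u} B∣1+A B∣s s<[1+A]u Au≤1+s =
  ≤-trans (∣⇒≤ {{>-nonZero 0<d}} B∣d) d≤1+u
  where
  d = suc A * u ∸ s
  B∣d : B ∣ d
  B∣d = ∣m+n∣m⇒∣n (subst (B ∣_) (sym (m+[n∸m]≡n (<⇒≤ s<[1+A]u))) (∣m⇒∣m*n u B∣1+A)) B∣s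
  0<d : 0 < d
  0<d = m<n⇒0<n∸m s<[1+A]u
  d≤1+u : d ≤ suc u
  d≤1+u = m≤n+o⇒m∸n≤o (suc A * u) s (begin
    u + A * u    ≤⟨ +-monoʳ-≤ u Au≤1+s ⟩
    u + suc s    ≡⟨ +-suc u s ⟩
    suc u + s    ≡⟨ +-comm (suc u) s ⟩
    s + suc u    ∎)
    where open ≤-Reasoning

∣-adjacent : ∀ {d r} → d ∣ r ⊎ d ∣ suc r → ∃[ s ] (d ∣ s × r ≤ s × s ≤ suc r)
∣-adjacent {r = r} (inj₁ d∣r)   = r , d∣r , ≤-refl , n≤1+n r
∣-adjacent {r = r} (inj₂ d∣1+r) = suc r , d∣1+r , n≤1+n r , ≤-refl

A*B≤1+r+A : ∀ {A B r} → B ∣ suc A → 1 ≤ r → 2 * A ∣ r ⊎ 2 * A ∣ suc r → B ∣ r ⊎ B ∣ suc r →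
            A * B ≤ suc r + A
A*B≤1+r+A {A} {B} {r} B∣1+A 1≤r 2A∣r⊎1+r B∣r⊎1+r with ∣-adjacent 2A∣r⊎1+r | ∣-adjacent B∣r⊎1+r
... | x , divides zero x≡0 , r≤x , _ | _ =
  contradiction (≤-trans 1≤r (≤-trans r≤x (≤-reflexive x≡0))) λ ()
... | x , divides (suc t) x≡[1+t]*2A , r≤x , x≤1+r | s , B∣s , r≤s , s≤1+r = begin
  A * B        ≤⟨ *-monoʳ-≤ A (∣-near-multiple⇒≤ B∣1+A B∣s s<[1+A]u Au≤1+s) ⟩
  A * suc u    ≡⟨ *-suc A u ⟩
  A + A * u    ≤⟨ +-monoʳ-≤ A (≤-trans (≤-reflexive Au≡x) x≤1+r) ⟩
  A + suc r    ≡⟨ +-comm A (suc r) ⟩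
  suc r + A    ∎
  where
  open ≤-Reasoning
  u = suc t * 2
  Au≡x : A * u ≡ x
  Au≡x = trans (regroup A t) (sym x≡[1+t]*2A)
    where
    regroup : ∀ A t → A * (suc t * 2) ≡ suc t * (2 * A)
    regroup = solve-∀
  s<[1+A]u : s < suc A * u
  s<[1+A]u = begin-strict
    s                  ≤⟨ s≤1+r ⟩
    suc r              ≤⟨ s≤s r≤x ⟩
    suc x              <⟨ n<1+n (suc x) ⟩
    2 + x              ≤⟨ +-monoˡ-≤ x (s≤s (s≤s z≤n)) ⟩
    u + x              ≡⟨ cong (u +_) Au≡x ⟨
    suc A * u          ∎
  Au≤1+s : A * u ≤ suc s
  Au≤1+s = ≤-trans (≤-reflexive Au≡x) (≤-trans x≤1+r (s≤s r≤s))

A*B≤1+Z[A*B]+A : ∀ a j {q} → Prime q → q ^ j ∣ suc (2 ^ suc a) →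
                 2 ^ suc a * q ^ j ≤ suc (Z (2 ^ suc a * q ^ j)) + 2 ^ suc a
A*B≤1+Z[A*B]+A a j {q} q-prime B∣1+A =
  A*B≤1+r+A B∣1+A (Z-positive (A * B))
    (p^e∣m*n⇒p^e∣m⊎p^e∣n (suc (suc a)) prime[2] (coprime-suc r) (m*n∣⇒m∣ (2 * A) B 2AB∣r[1+r]))
    (p^e∣m*n⇒p^e∣m⊎p^e∣n j q-prime (coprime-suc r) (m*n∣⇒n∣ (2 * A) B 2AB∣r[1+r]))
  where
  A = 2 ^ suc a
  B = q ^ j
  r = Z (A * B)
  instance
    AB≢0 : NonZero (A * B)
    AB≢0 = m*n≢0 A B {{m^n≢0 2 (suc a)}} {{m^n≢0 q j {{prime⇒nonZero q-prime}}}}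
  regroup : ∀ A B → A * B * 2 ≡ 2 * A * B
  regroup = solve-∀
  2AB∣r[1+r] : 2 * A * B ∣ r * suc r
  2AB∣r[1+r] = subst (_∣ r * suc r) (regroup A B) (∣T⇒*2∣m*[1+m] {m = r} (Z-divides (A * B)))

A*[3+C]≤1+r+A⇒C*A<r : ∀ {A C r} → .{{NonZero A}} → A * (3 + C) ≤ suc r + A → C * A < r
A*[3+C]≤1+r+A⇒C*A<r {A@(suc a)} {C} {r} A[3+C]≤1+r+A = +-cancelʳ-≤ (suc A) (suc (C * A)) r (begin
  suc (C * A) + suc A             ≤⟨ m≤m+n _ (a + a) ⟩
  suc (C * A) + suc A + (a + a)   ≡⟨ expand a C ⟩
  A * (3 + C)                     ≤⟨ A[3+C]≤1+r+A ⟩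
  suc r + A                       ≡⟨ +-suc r A ⟨
  r + suc A                       ∎)
  where
  open ≤-Reasoning
  expand : ∀ a C → suc (C * suc a) + suc (suc a) + (a + a) ≡ suc a * (3 + C)
  expand = solve-∀

prime[3] : Prime 3
prime[3] = toWitness {a? = prime? 3} _

theorem3 : (C : ℕ) → ∃[ n ] (n ≥ 1 × C * Z n < Z (2 * n))
theorem3 C = n , >-nonZero⁻¹ n , (begin-strict
  C * Z n     ≤⟨ *-monoʳ-≤ C (Z[m*d]≤2m P B B∣1+A) ⟩
  C * A       <⟨ A*[3+C]≤1+r+A⇒C*A<r (≤-trans (*-monoʳ-≤ A (3+n≤3^[1+n] C)) AB≤1+Z[AB]+A) ⟩
  Z (A * B)   ≡⟨ cong Z (*-assoc 2 P B) ⟩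
  Z (2 * n)   ∎)
  where
  open ≤-Reasoning
  a = pred (3 ^ C)
  P = 2 ^ a
  A = 2 * P
  B = 3 ^ suc C
  n = P * B
  instance
    P≢0 : NonZero P
    P≢0 = m^n≢0 2 a
    A≢0 : NonZero A
    A≢0 = m*n≢0 2 P
    B≢0 : NonZero B
    B≢0 = m^n≢0 3 (suc C)
    n≢0 : NonZero n
    n≢0 = m*n≢0 P B
  B∣1+A : B ∣ suc A
  B∣1+A = subst (λ e → B ∣ suc (2 ^ e)) (sym (suc-pred (3 ^ C) {{m^n≢0 3 C}})) (3^[1+k]∣1+2^3^k C)
  AB≤1+Z[AB]+A : A * B ≤ suc (Z (A * B)) + A
  AB≤1+Z[AB]+A = A*B≤1+Z[A*B]+A a (suc C) prime[3] B∣1+A
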